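{- Let $\mathbb{F}\in\{\mathbb{R},\mathbb{C}\}$, $d\geq 1$, $H=\mathbb{F}^d$, let $p,q,r$ be distinct atoms and $\mathrm{SEP}\text{ - }1 := (p\wedge(q\vee r))\wedge \neg\bigl((p\wedge q)\vee(p\wedge r)\bigr)$. If $v$ is a projector valuation such that $[\![\mathrm{SEP}\text{ - }1]\!]^{\mathrm{PBA}}_v$ is defined, then $v(p),v(q),v(r)$ commute pairwise.
   Context: $\mathrm{Proj}(H)$ is the set of orthogonal projectors on $H=\mathbb{F}^d$. A projector valuation is a map $v$ from atoms to $\mathrm{Proj}(H)$. PBA values are defined recursively and partially: $[\![p_i]\!]=v(p_i)$; $[\![\neg\theta]\!]=I-[\![\theta]\!]$ if $[\![\theta]\!]$ is defined; $[\![\alpha\wedge\beta]\!]=[\![\alpha]\!][\![\beta]\!]$ and $[\![\alpha\vee\beta]\!]=[\![\alpha]\!]+[\![\beta]\!]-[\![\alpha]\!][\![\beta]\!]$, each defined only if $[\![\alpha]\!],[\![\beta]\!]$ are both defined and commute. -}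

module Defs where

open import Level using (_⊔_)
open import Data.Nat using (ℕ; zero; suc)
import Data.Fin as Fin
open Fin using (Fin)
import Relation.Nullary
open import Data.Product using (Σ; ∃; _×_; _,_)
open import Relation.Nullary using (¬_)
open import Algebra.Bundles using (CommutativeRing)

data Formula : Set where
  atom : ℕ → Formula
  ¬ᶠ_  : Formula → Formula
  _∧ᶠ_ : Formula → Formula → Formula
  _∨ᶠ_ : Formula → Formula → Formula

infix  7 ¬ᶠ_
infixl 6 _∧ᶠ_
infixl 5 _∨ᶠ_

SEP1 : ℕ → ℕ → ℕ → Formula
SEP1 p q r = (atom p ∧ᶠ (atom q ∨ᶠ atom r)) ∧ᶠ (¬ᶠ ((atom p ∧ᶠ atom q) ∨ᶠ (atom p ∧ᶠ atom r)))

-- The scalar field 𝔽: a commutative ring that is a field, equipped with a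
-- conjugation (involutive ring automorphism); ℝ (trivial conjugation) and
-- ℂ (complex conjugation) are instances.
module _ {c ℓ} (R : CommutativeRing c ℓ) where
  open CommutativeRing R

  record IsStarField (conj : Carrier → Carrier) : Set (c ⊔ ℓ) where
    field
      1≉0       : ¬ (1# ≈ 0#)
      inverse   : ∀ x → ¬ (x ≈ 0#) → ∃ λ y → x * y ≈ 1#
      conj-cong : ∀ {x y} → x ≈ y → conj x ≈ conj y
      conj-invol : ∀ x → conj (conj x) ≈ x
      conj-+    : ∀ x y → conj (x + y) ≈ conj x + conj y
      conj-*    : ∀ x y → conj (x * y) ≈ conj x * conj y
      conj-1    : conj 1# ≈ 1#

  -- d × d matrices over 𝔽, i.e. linear operators on H = 𝔽^d.
  Mat : ℕ → Set c
  Mat d = Fin d → Fin d → Carrier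

  module _ {d : ℕ} where
    _≈ᴹ_ : Mat d → Mat d → Set ℓ
    A ≈ᴹ B = ∀ i j → A i j ≈ B i j

    Σᶠ : ∀ {n} → (Fin n → Carrier) → Carrier
    Σᶠ {zero}  f = 0#
    Σᶠ {suc n} f = f Fin.zero + Σᶠ (λ i → f (Fin.suc i))

    _·ᴹ_ : Mat d → Mat d → Mat d
    (A ·ᴹ B) i j = Σᶠ (λ k → A i k * B k j)

    _+ᴹ_ : Mat d → Mat d → Mat d
    (A +ᴹ B) i j = A i j + B i j

    _-ᴹ_ : Mat d → Mat d → Mat d
    (A -ᴹ B) i j = A i j - B i j

    Iᴹ : Mat d
    Iᴹ i j with i Fin.≟ j
    ... | Relation.Nullary.yes _ = 1#
    ... | Relation.Nullary.no  _ = 0#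

    _†[_] : Mat d → (Carrier → Carrier) → Mat d
    (A †[ conj ]) i j = conj (A j i)

    Commute : Mat d → Mat d → Set ℓ
    Commute A B = (A ·ᴹ B) ≈ᴹ (B ·ᴹ A)

    IsProj : (Carrier → Carrier) → Mat d → Set ℓ
    IsProj conj P = ((P ·ᴹ P) ≈ᴹ P) × ((P †[ conj ]) ≈ᴹ P)

    -- PBA semantics as a (functional) relation:  ⟦ φ ⟧ᵥ is defined and equals M.
    data ⟦_⟧[_]↦_ : Formula → (ℕ → Mat d) → Mat d → Set (c ⊔ ℓ) where
      atom↦ : ∀ {v} i → ⟦ atom i ⟧[ v ]↦ v i
      ¬↦    : ∀ {v θ M} → ⟦ θ ⟧[ v ]↦ M → ⟦ ¬ᶠ θ ⟧[ v ]↦ (Iᴹ -ᴹ M)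
      ∧↦    : ∀ {v α β A B} → ⟦ α ⟧[ v ]↦ A → ⟦ β ⟧[ v ]↦ B → Commute A B →
              ⟦ α ∧ᶠ β ⟧[ v ]↦ (A ·ᴹ B)
      ∨↦    : ∀ {v α β A B} → ⟦ α ⟧[ v ]↦ A → ⟦ β ⟧[ v ]↦ B → Commute A B →
              ⟦ α ∨ᶠ β ⟧[ v ]↦ ((A +ᴹ B) -ᴹ (A ·ᴹ B))

    Defined : (ℕ → Mat d) → Formula → Set (c ⊔ ℓ)
    Defined v φ = Σ (Mat d) λ M → ⟦ φ ⟧[ v ]↦ M

{-# OPTIONS --safe #-}
module Submission where

open import Defs
open import Level using (Level)
open import Data.Nat using (ℕ; _≥_)
open import Data.Product using (_×_; _,_)
open import Relation.Binary.PropositionalEquality using (_≢_)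
open import Algebra.Bundles using (CommutativeRing)

module _ {c ℓ} (𝔽 : CommutativeRing c ℓ) {d : ℕ} {v : ℕ → Mat 𝔽 d} where

  ¬-defined : ∀ {θ} → Defined 𝔽 v (¬ᶠ θ) → Defined 𝔽 v θ
  ¬-defined (_ , ¬↦ θ↦) = _ , θ↦

  ∧-definedˡ : ∀ {α β} → Defined 𝔽 v (α ∧ᶠ β) → Defined 𝔽 v α
  ∧-definedˡ (_ , ∧↦ α↦ _ _) = _ , α↦

  ∧-definedʳ : ∀ {α β} → Defined 𝔽 v (α ∧ᶠ β) → Defined 𝔽 v β
  ∧-definedʳ (_ , ∧↦ _ β↦ _) = _ , β↦

  ∨-definedˡ : ∀ {α β} → Defined 𝔽 v (α ∨ᶠ β) → Defined 𝔽 v α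
  ∨-definedˡ (_ , ∨↦ α↦ _ _) = _ , α↦

  ∨-definedʳ : ∀ {α β} → Defined 𝔽 v (α ∨ᶠ β) → Defined 𝔽 v β
  ∨-definedʳ (_ , ∨↦ _ β↦ _) = _ , β↦

  atom-∧-defined⇒commute : ∀ {i j} → Defined 𝔽 v (atom i ∧ᶠ atom j) →
                           Commute 𝔽 (v i) (v j)
  atom-∧-defined⇒commute (_ , ∧↦ (atom↦ _) (atom↦ _) vi∘vj) = vi∘vj

  atom-∨-defined⇒commute : ∀ {i j} → Defined 𝔽 v (atom i ∨ᶠ atom j) →
                           Commute 𝔽 (v i) (v j)
  atom-∨-defined⇒commute (_ , ∨↦ (atom↦ _) (atom↦ _) vi∘vj) = vi∘vj

-- The commutations are side conditions of the definedness of p ∧ q, q ∨ r and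
-- p ∧ r.
mainTheorem11 : ∀ {c ℓ : Level} (𝔽 : CommutativeRing c ℓ)
    (conj : CommutativeRing.Carrier 𝔽 → CommutativeRing.Carrier 𝔽) →
    IsStarField 𝔽 conj →
    (d : ℕ) → d ≥ 1 →
    (p q r : ℕ) → p ≢ q → q ≢ r → p ≢ r →
    (v : ℕ → Mat 𝔽 d) → (∀ i → IsProj 𝔽 conj (v i)) →
    Defined 𝔽 v (SEP1 p q r) →
    Commute 𝔽 (v p) (v q) × Commute 𝔽 (v q) (v r) × Commute 𝔽 (v p) (v r)
mainTheorem11 𝔽 _ _ _ _ p q r _ _ _ v _ sep₁ =
  atom-∧-defined⇒commute 𝔽 (∨-definedˡ 𝔽 negated) ,
  atom-∨-defined⇒commute 𝔽 (∧-definedʳ 𝔽 (∧-definedˡ 𝔽 sep₁)) ,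
  atom-∧-defined⇒commute 𝔽 (∨-definedʳ 𝔽 negated)
  where
  negated : Defined 𝔽 v ((atom p ∧ᶠ atom q) ∨ᶠ (atom p ∧ᶠ atom r))
  negated = ¬-defined 𝔽 (∧-definedʳ 𝔽 sep₁)
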